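{- Let $(a_m)_{m\ge 0}$ and $(b_m)_{m\ge 0}$ be sequences of constants, and let $(I_{k,m})_{k,m\ge 0}$ be a doubly indexed sequence satisfying, for all integers $k\ge 1$ and $m\ge 0$, $$I_{k,m}=a_m I_{k-1,m+1}-b_m I_{k-1,m}.$$ Then for all integers $k\ge 0$ and $m\ge 0$, $$I_{k,m}=\sum_{l=0}^{k-1}\left(\prod_{j=0}^{l}a_{m+j}\right)\left(\sum_{\substack{(r_0,\dots,r_{l+1})\in\mathbb{N}_0^{l+2}\\ r_0+\cdots+r_{l+1}=k-l-1}}\ \prod_{h=0}^{l+1}b_{m+h}^{r_h}\right)I_{0,m+l+1}\,(-1)^{k-l+1}+(-1)^k b_m^k I_{0,m}.$$
   Context: $\mathbb{N}_0$ denotes the set of nonnegative integers. The convention $x^0=1$ (including $0^0=1$) is used, and an empty sum equals $0$. -}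

module Defs where

open import Level using (Level)
open import Data.Nat using (ℕ; zero; suc; _∸_)
open import Data.List using (List; []; _∷_; map; concatMap; upTo)
open import Data.Vec using (Vec; []; _∷_)
open import Algebra.Bundles using (CommutativeRing; Semiring)

-- All weak compositions of s into n parts: the list of all
-- (r_0,…,r_{n-1}) ∈ ℕ₀ⁿ with r_0 + ⋯ + r_{n-1} = s (each exactly once).
compositions : (n s : ℕ) → List (Vec ℕ n)
compositions zero    zero    = [] ∷ []
compositions zero    (suc s) = []
compositions (suc n) s       =
  concatMap (λ r → map (r ∷_) (compositions n (s ∸ r))) (upTo (suc s))

module RingSums {c ℓ : Level} (R : CommutativeRing c ℓ) where
  open CommutativeRing R
  open import Algebra.Definitions.RawSemiring (Semiring.rawSemiring semiring) using (_^_) public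

  sumTo : ℕ → (ℕ → Carrier) → Carrier
  sumTo zero    f = 0#
  sumTo (suc n) f = sumTo n f + f n

  prodTo : ℕ → (ℕ → Carrier) → Carrier
  prodTo zero    f = 1#
  prodTo (suc n) f = prodTo n f * f n

  sumList : List Carrier → Carrier
  sumList []       = 0#
  sumList (x ∷ xs) = x + sumList xs

  prodPow : {n : ℕ} → (ℕ → Carrier) → ℕ → Vec ℕ n → Carrier
  prodPow g h []       = 1#
  prodPow g h (r ∷ rs) = (g h ^ r) * prodPow g (suc h) rs

  compSum : (b : ℕ → Carrier) (m n s : ℕ) → Carrier
  compSum b m n s = sumList (map (prodPow b m) (compositions n s))

-- Put term m j s = (-1)^s (Π_{i<j} a_{m+i}) h_s(b_m,…,b_{m+j}) I_{0,m+j}, where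
-- h_s is the complete homogeneous symmetric polynomial (the inner sum of the
-- statement). Peeling off the variable b_m gives the Pascal rule
-- h_{s+1}(b_m,…,b_{m+j}) = h_{s+1}(b_{m+1},…,b_{m+j}) + b_m h_s(b_m,…,b_{m+j}),
-- which turns into term m j (s+1) = a_m term (m+1) (j-1) (s+1) - b_m term m j s.
-- Summed over the antidiagonal j + s = k this says that closedForm k m = Σ_{j+s=k} term m j s
-- satisfies the recurrence of I; both agree at k = 0, hence everywhere, and it is the
-- right-hand side of the statement with j = l + 1, plus the summand j = 0.
module Submission where

open import Defs
open import Level using (Level)
open import Data.Nat using (ℕ; zero; suc; _+_; _∸_; _<_)
import Data.Nat.Properties as ℕ
open import Algebra.Bundles using (CommutativeRing)
open import Data.List using (List; []; _∷_; map; concatMap; upTo; _++_)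
open import Data.List.Properties using (map-++; map-∘; map-upTo)
open import Data.Vec using (Vec; _∷_)
open import Function using (_∘_)
open import Relation.Binary.PropositionalEquality as ≡ using (_≡_; cong; cong₂)

map-upTo-suc : ∀ {a} {A : Set a} (f : ℕ → A) n → map f (upTo (suc n)) ≡ f 0 ∷ map (f ∘ suc) (upTo n)
map-upTo-suc f n = ≡.trans (map-upTo f (suc n)) (cong (f 0 ∷_) (≡.sym (map-upTo (f ∘ suc) n)))

module RingIdentities {c ℓ : Level} (R : CommutativeRing c ℓ) where
  open CommutativeRing R renaming (_+_ to _+ᴿ_)
  open import Algebra.Solver.Ring.NaturalCoefficients.Default commutativeSemiring

  factor-out-middle : ∀ σ α p x → σ * (α * p) * x ≈ α * (σ * p * x)
  factor-out-middle = solve 4 (λ σ α p x → σ :* (α :* p) :* x := α :* (σ :* p :* x)) refl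

  distrib-scaled : ∀ n σ p β x y → (n * σ) * p * (x +ᴿ β * y) ≈ (n * σ) * p * x +ᴿ n * β * (σ * p * y)
  distrib-scaled = solve 6 (λ n σ p β x y →
    (n :* σ) :* p :* (x :+ β :* y) := (n :* σ) :* p :* x :+ n :* β :* (σ :* p :* y)) refl

  collect-α : ∀ α β q y x → (α * q +ᴿ β * y) +ᴿ α * x ≈ α * (q +ᴿ x) +ᴿ β * y
  collect-α = solve 5 (λ α β q y x → (α :* q :+ β :* y) :+ α :* x := α :* (q :+ x) :+ β :* y) refl

  collect-α-β : ∀ α β q y x z → (α * q +ᴿ β * y) +ᴿ (α * x +ᴿ β * z) ≈ α * (q +ᴿ x) +ᴿ β * (y +ᴿ z)
  collect-α-β = solve 6 (λ α β q y x z →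
    (α :* q :+ β :* y) :+ (α :* x :+ β :* z) := α :* (q :+ x) :+ β :* (y :+ z)) refl

  move-last : ∀ σ p i x → σ * (p * i) * x ≈ p * x * i * σ
  move-last = solve 4 (λ σ p i x → σ :* (p :* i) :* x := p :* x :* i :* σ) refl

  swap-last : ∀ σ i x → σ * i * x ≈ σ * x * i
  swap-last = solve 3 (λ σ i x → σ :* i :* x := σ :* x :* i) refl

module _ {c ℓ : Level} (R : CommutativeRing c ℓ) where
  open CommutativeRing R renaming (_+_ to _+ᴿ_)
  open RingSums R
  open RingIdentities R
  open import Algebra.Properties.Ring ring using (-1*x≈-x; -‿distribˡ-*; -‿involutive)
  open import Relation.Binary.Reasoning.Setoid setoid

  -1*[-1*x]≈x : ∀ x → - 1# * (- 1# * x) ≈ x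
  -1*[-1*x]≈x x = trans (-1*x≈-x _) (trans (-‿cong (-1*x≈-x x)) (-‿involutive x))

  sumList-++ : ∀ xs ys → sumList (xs ++ ys) ≈ sumList xs +ᴿ sumList ys
  sumList-++ []       ys = sym (+-identityˡ _)
  sumList-++ (x ∷ xs) ys = trans (+-congˡ (sumList-++ xs ys)) (sym (+-assoc _ _ _))

  sumList-map-cong : ∀ {A : Set} {f g : A → Carrier} → (∀ x → f x ≈ g x) →
    ∀ xs → sumList (map f xs) ≈ sumList (map g xs)
  sumList-map-cong f≈g []       = refl
  sumList-map-cong f≈g (x ∷ xs) = +-cong (f≈g x) (sumList-map-cong f≈g xs)

  sumList-map-*ˡ : ∀ {A : Set} y (f : A → Carrier) xs →
    sumList (map (λ x → y * f x) xs) ≈ y * sumList (map f xs)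
  sumList-map-*ˡ y f []       = sym (zeroʳ y)
  sumList-map-*ˡ y f (x ∷ xs) = trans (+-congˡ (sumList-map-*ˡ y f xs)) (sym (distribˡ _ _ _))

  sumList-map-concatMap : ∀ {A B : Set} (f : B → Carrier) (g : A → List B) xs →
    sumList (map f (concatMap g xs)) ≈ sumList (map (λ x → sumList (map f (g x))) xs)
  sumList-map-concatMap f g []       = refl
  sumList-map-concatMap f g (x ∷ xs) = begin
    sumList (map f (g x ++ concatMap g xs))           ≡⟨ cong sumList (map-++ f (g x) (concatMap g xs)) ⟩
    sumList (map f (g x) ++ map f (concatMap g xs))   ≈⟨ sumList-++ (map f (g x)) _ ⟩
    sumList (map f (g x)) +ᴿ sumList (map f (concatMap g xs))
                                                      ≈⟨ +-congˡ (sumList-map-concatMap f g xs) ⟩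
    sumList (map (λ x → sumList (map f (g x))) (x ∷ xs)) ∎

  sumTo-peel : ∀ k f → sumTo (suc k) f ≈ f 0 +ᴿ sumTo k (f ∘ suc)
  sumTo-peel zero    f = +-comm _ _
  sumTo-peel (suc k) f = trans (+-congʳ (sumTo-peel k f)) (+-assoc _ _ _)

  sumTo-cong-< : ∀ k {f g} → (∀ l → l < k → f l ≈ g l) → sumTo k f ≈ sumTo k g
  sumTo-cong-< zero    f≈g = refl
  sumTo-cong-< (suc k) f≈g = +-cong (sumTo-cong-< k (λ l l<k → f≈g l (ℕ.m<n⇒m<1+n l<k))) (f≈g k ℕ.≤-refl)

  prodTo-peel : ∀ j f → prodTo (suc j) f ≈ f 0 * prodTo j (f ∘ suc)
  prodTo-peel zero    f = *-comm _ _
  prodTo-peel (suc j) f = trans (*-congʳ (prodTo-peel j f)) (*-assoc _ _ _)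

  prodTo-cong : ∀ j {f g} → (∀ i → f i ≈ g i) → prodTo j f ≈ prodTo j g
  prodTo-cong zero    f≈g = refl
  prodTo-cong (suc j) f≈g = *-cong (prodTo-cong j f≈g) (f≈g j)

  module _ (b : ℕ → Carrier) where

    compSum-expand : ∀ m n s → compSum b m (suc n) s
      ≈ sumList (map (λ r → b m ^ r * compSum b (suc m) n (s ∸ r)) (upTo (suc s)))
    compSum-expand m n s = begin
      sumList (map (prodPow b m) (concatMap withHead (upTo (suc s))))
        ≈⟨ sumList-map-concatMap (prodPow b m) withHead (upTo (suc s)) ⟩
      sumList (map (λ r → sumList (map (prodPow b m) (withHead r))) (upTo (suc s)))
        ≈⟨ sumList-map-cong factor (upTo (suc s)) ⟩
      sumList (map (λ r → b m ^ r * compSum b (suc m) n (s ∸ r)) (upTo (suc s))) ∎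
      where
      withHead : ℕ → List (Vec ℕ (suc n))
      withHead r = map (r ∷_) (compositions n (s ∸ r))

      factor : ∀ r → sumList (map (prodPow b m) (withHead r)) ≈ b m ^ r * compSum b (suc m) n (s ∸ r)
      factor r = trans (reflexive (cong sumList (≡.sym (map-∘ (compositions n (s ∸ r))))))
                       (sumList-map-*ˡ (b m ^ r) (prodPow b (suc m)) (compositions n (s ∸ r)))

    compSum-zero : ∀ m n → compSum b m n 0 ≈ 1#
    compSum-zero m zero    = +-identityʳ 1#
    compSum-zero m (suc n) = begin
      compSum b m (suc n) 0              ≈⟨ compSum-expand m n 0 ⟩
      1# * compSum b (suc m) n 0 +ᴿ 0#   ≈⟨ +-identityʳ _ ⟩
      1# * compSum b (suc m) n 0         ≈⟨ *-identityˡ _ ⟩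
      compSum b (suc m) n 0              ≈⟨ compSum-zero (suc m) n ⟩
      1#                                 ∎

    compSum-pascal : ∀ m n s →
      compSum b m (suc n) (suc s) ≈ compSum b (suc m) n (suc s) +ᴿ b m * compSum b m (suc n) s
    compSum-pascal m n s = begin
      compSum b m (suc n) (suc s)
        ≈⟨ compSum-expand m n (suc s) ⟩
      sumList (map term (upTo (suc (suc s))))
        ≡⟨ cong sumList (map-upTo-suc term (suc s)) ⟩
      1# * compSum b (suc m) n (suc s) +ᴿ sumList (map (term ∘ suc) (upTo (suc s)))
        ≈⟨ +-cong (*-identityˡ _) (sumList-map-cong (λ r → *-assoc _ _ _) (upTo (suc s))) ⟩
      compSum b (suc m) n (suc s) +ᴿ sumList (map (λ r → b m * term′ r) (upTo (suc s)))
        ≈⟨ +-congˡ (sumList-map-*ˡ (b m) term′ (upTo (suc s))) ⟩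
      compSum b (suc m) n (suc s) +ᴿ b m * sumList (map term′ (upTo (suc s)))
        ≈⟨ +-congˡ (*-congˡ (sym (compSum-expand m n s))) ⟩
      compSum b (suc m) n (suc s) +ᴿ b m * compSum b m (suc n) s ∎
      where
      term term′ : ℕ → Carrier
      term  r = b m ^ r * compSum b (suc m) n (suc s ∸ r)
      term′ r = b m ^ r * compSum b (suc m) n (s ∸ r)

    compSum-one : ∀ m s → compSum b m 1 s ≈ b m ^ s
    compSum-one m zero    = compSum-zero m 1
    compSum-one m (suc s) = trans (compSum-pascal m 0 s) (trans (+-identityˡ _) (*-congˡ (compSum-one m s)))

  antidiagonalSum : (ℕ → ℕ → Carrier) → ℕ → Carrier
  antidiagonalSum f zero    = f 0 0
  antidiagonalSum f (suc k) = f 0 (suc k) +ᴿ antidiagonalSum (f ∘ suc) k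

  antidiagonalSum-unfold : ∀ f k → antidiagonalSum f k ≈ f 0 k +ᴿ sumTo k (λ l → f (suc l) (k ∸ suc l))
  antidiagonalSum-unfold f zero    = sym (+-identityʳ _)
  antidiagonalSum-unfold f (suc k) =
    +-congˡ (trans (antidiagonalSum-unfold (f ∘ suc) k) (sym (sumTo-peel k _)))

  -- q plays the role of a row of Q with index -1.
  antidiagonalSum-recurrence : ∀ α β (q : ℕ → Carrier) (X Q Y : ℕ → ℕ → Carrier) →
    (∀ s → X 0 (suc s) ≈ α * q s +ᴿ β * Y 0 s) →
    (∀ j → X (suc j) 0 ≈ α * Q j 0) →
    (∀ j s → X (suc j) (suc s) ≈ α * Q j (suc s) +ᴿ β * Y (suc j) s) →
    ∀ k → antidiagonalSum X (suc k) ≈ α * (q k +ᴿ antidiagonalSum Q k) +ᴿ β * antidiagonalSum Y k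
  antidiagonalSum-recurrence α β q X Q Y column row inner zero =
    trans (+-cong (column 0) (row 0)) (collect-α α β _ _ _)
  antidiagonalSum-recurrence α β q X Q Y column row inner (suc k) =
    trans (+-cong (column (suc k))
                  (antidiagonalSum-recurrence α β (Q 0 ∘ suc) (X ∘ suc) (Q ∘ suc) (Y ∘ suc)
                     (inner 0) (row ∘ suc) (inner ∘ suc) k))
          (collect-α-β α β _ _ _ _)

  SolvesRecurrence : (a b : ℕ → Carrier) → (ℕ → ℕ → Carrier) → Set ℓ
  SolvesRecurrence a b I = ∀ k m → I (suc k) m ≈ a m * I k (suc m) +ᴿ - (b m * I k m)

  recurrence-unique : ∀ {a b} {I J : ℕ → ℕ → Carrier} → SolvesRecurrence a b I → SolvesRecurrence a b J →
    (∀ m → I 0 m ≈ J 0 m) → ∀ k m → I k m ≈ J k m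
  recurrence-unique I-rec J-rec I≈J zero    m = I≈J m
  recurrence-unique I-rec J-rec I≈J (suc k) m = begin
    _ ≈⟨ I-rec k m ⟩
    _ ≈⟨ +-cong (*-congˡ (recurrence-unique I-rec J-rec I≈J k (suc m)))
                (-‿cong (*-congˡ (recurrence-unique I-rec J-rec I≈J k m))) ⟩
    _ ≈⟨ sym (J-rec k m) ⟩
    _ ∎

  module _ (a b : ℕ → Carrier) (I : ℕ → ℕ → Carrier) where

    A : ℕ → ℕ → Carrier
    A m j = prodTo j (λ i → a (m + i))

    AI : ℕ → ℕ → Carrier
    AI m j = A m j * I 0 (m + j)

    term : ℕ → ℕ → ℕ → Carrier
    term m j s = (- 1#) ^ s * AI m j * compSum b m (suc j) s

    closedForm : ℕ → ℕ → Carrier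
    closedForm k m = antidiagonalSum (term m) k

    A-peel : ∀ m j → A m (suc j) ≈ a m * A (suc m) j
    A-peel m j = trans (prodTo-peel j _)
      (*-cong (reflexive (cong a (ℕ.+-identityʳ m))) (prodTo-cong j (λ i → reflexive (cong a (ℕ.+-suc m i)))))

    AI-peel : ∀ m j → AI m (suc j) ≈ a m * AI (suc m) j
    AI-peel m j = trans (*-cong (A-peel m j) (reflexive (cong (I 0) (ℕ.+-suc m j)))) (*-assoc _ _ _)

    term-suc : ∀ m j s →
      term m j (suc s) ≈ (- 1# * (- 1#) ^ s) * AI m j * compSum b (suc m) j (suc s) +ᴿ - b m * term m j s
    term-suc m j s = begin
      term m j (suc s)
        ≈⟨ *-congˡ (compSum-pascal b m j s) ⟩
      (- 1# * (- 1#) ^ s) * AI m j * (compSum b (suc m) j (suc s) +ᴿ b m * compSum b m (suc j) s)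
        ≈⟨ distrib-scaled (- 1#) ((- 1#) ^ s) (AI m j) (b m) _ _ ⟩
      (- 1# * (- 1#) ^ s) * AI m j * compSum b (suc m) j (suc s) +ᴿ - 1# * b m * term m j s
        ≈⟨ +-congˡ (*-congʳ (-1*x≈-x (b m))) ⟩
      (- 1# * (- 1#) ^ s) * AI m j * compSum b (suc m) j (suc s) +ᴿ - b m * term m j s ∎

    term-column : ∀ m s → term m 0 (suc s) ≈ a m * 0# +ᴿ - b m * term m 0 s
    term-column m s = trans (term-suc m 0 s) (+-congʳ (trans (zeroʳ _) (sym (zeroʳ _))))

    term-row : ∀ m j → term m (suc j) 0 ≈ a m * term (suc m) j 0
    term-row m j = trans (*-cong (*-congˡ (AI-peel m j))
                                 (trans (compSum-zero b m (suc (suc j))) (sym (compSum-zero b (suc m) (suc j)))))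
                         (factor-out-middle 1# (a m) _ _)

    term-inner : ∀ m j s → term m (suc j) (suc s) ≈ a m * term (suc m) j (suc s) +ᴿ - b m * term m (suc j) s
    term-inner m j s = trans (term-suc m (suc j) s)
      (+-congʳ (trans (*-congʳ (*-congˡ (AI-peel m j))) (factor-out-middle _ (a m) _ _)))

    closedForm-solves : SolvesRecurrence a b closedForm
    closedForm-solves k m = trans
      (antidiagonalSum-recurrence (a m) (- b m) (λ _ → 0#) (term m) (term (suc m)) (term m)
        (term-column m) (term-row m) (term-inner m) k)
      (+-cong (*-congˡ (+-identityˡ _)) (sym (-‿distribˡ-* (b m) _)))

    closedForm-initial : ∀ m → I 0 m ≈ closedForm 0 m
    closedForm-initial m = sym (begin
      1# * (1# * I 0 (m + 0)) * compSum b m 1 0   ≈⟨ *-cong (trans (*-identityˡ _) (*-identityˡ _)) (compSum-zero b m 1) ⟩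
      I 0 (m + 0) * 1#                           ≈⟨ *-identityʳ _ ⟩
      I 0 (m + 0)                                ≡⟨ cong (I 0) (ℕ.+-identityʳ m) ⟩
      I 0 m                                      ∎)

    summand : ∀ m k l → l < k → term m (suc l) (k ∸ suc l) ≈
      prodTo (suc l) (λ j → a (m + j)) * compSum b m (l + 2) (k ∸ l ∸ 1) * I 0 (m + l + 1) * (- 1#) ^ (k ∸ l + 1)
    summand m k l l<k = begin
      σ * (A m (suc l) * I 0 (m + suc l)) * compSum b m (2 + l) s
        ≈⟨ move-last σ _ _ _ ⟩
      A m (suc l) * compSum b m (2 + l) s * I 0 (m + suc l) * σ
        ≈⟨ *-congˡ (sym (-1*[-1*x]≈x σ)) ⟩
      A m (suc l) * compSum b m (2 + l) s * I 0 (m + suc l) * (- 1#) ^ (2 + s)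
        ≡⟨ cong₂ (λ n i → A m (suc l) * compSum b m n s * I 0 i * (- 1#) ^ (2 + s))
                 (ℕ.+-comm 2 l) (≡.trans (cong (m +_) (ℕ.+-comm 1 l)) (≡.sym (ℕ.+-assoc m l 1))) ⟩
      A m (suc l) * compSum b m (l + 2) s * I 0 (m + l + 1) * (- 1#) ^ (2 + s)
        ≡⟨ cong₂ (λ s′ e → A m (suc l) * compSum b m (l + 2) s′ * I 0 (m + l + 1) * (- 1#) ^ e)
                 (≡.trans (cong (k ∸_) (ℕ.+-comm 1 l)) (≡.sym (ℕ.∸-+-assoc k l 1)))
                 (≡.trans (cong suc (≡.sym (ℕ.+-∸-assoc 1 l<k))) (ℕ.+-comm 1 (k ∸ l))) ⟩
      A m (suc l) * compSum b m (l + 2) (k ∸ l ∸ 1) * I 0 (m + l + 1) * (- 1#) ^ (k ∸ l + 1) ∎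
      where
      s : ℕ
      s = k ∸ suc l
      σ : Carrier
      σ = (- 1#) ^ s

    last-summand : ∀ m k → term m 0 k ≈ (- 1#) ^ k * b m ^ k * I 0 m
    last-summand m k = begin
      (- 1#) ^ k * (1# * I 0 (m + 0)) * compSum b m 1 k   ≈⟨ *-congʳ (*-congˡ (*-identityˡ _)) ⟩
      (- 1#) ^ k * I 0 (m + 0) * compSum b m 1 k          ≈⟨ swap-last _ _ _ ⟩
      (- 1#) ^ k * compSum b m 1 k * I 0 (m + 0)          ≈⟨ *-congʳ (*-congˡ (compSum-one b m k)) ⟩
      (- 1#) ^ k * b m ^ k * I 0 (m + 0)                  ≡⟨ cong (λ i → (- 1#) ^ k * b m ^ k * I 0 i) (ℕ.+-identityʳ m) ⟩
      (- 1#) ^ k * b m ^ k * I 0 m                        ∎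

    closedForm-explicit : ∀ k m → closedForm k m ≈
         sumTo k (λ l →
             prodTo (suc l) (λ j → a (m + j))
           * compSum b m (l + 2) (k ∸ l ∸ 1)
           * I 0 (m + l + 1)
           * (- 1#) ^ (k ∸ l + 1))
         +ᴿ ((- 1#) ^ k * b m ^ k * I 0 m)
    closedForm-explicit k m = begin
      closedForm k m
        ≈⟨ antidiagonalSum-unfold (term m) k ⟩
      term m 0 k +ᴿ sumTo k (λ l → term m (suc l) (k ∸ suc l))
        ≈⟨ +-comm _ _ ⟩
      sumTo k (λ l → term m (suc l) (k ∸ suc l)) +ᴿ term m 0 k
        ≈⟨ +-cong (sumTo-cong-< k (summand m k)) (last-summand m k) ⟩
      _ ∎

lemma2p1 : {c ℓ : Level} (R : CommutativeRing c ℓ) →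
    let open CommutativeRing R renaming (_+_ to _+ᴿ_)
        open RingSums R
    in (a b : ℕ → Carrier) (I : ℕ → ℕ → Carrier) →
       ((k m : ℕ) → I (suc k) m ≈ (a m * I k (suc m)) +ᴿ (- (b m * I k m))) →
       (k m : ℕ) →
       I k m ≈
         sumTo k (λ l →
             prodTo (suc l) (λ j → a (m + j))
           * compSum b m (l + 2) (k ∸ l ∸ 1)
           * I 0 (m + l + 1)
           * (- 1#) ^ (k ∸ l + 1))
         +ᴿ ((- 1#) ^ k * b m ^ k * I 0 m)
lemma2p1 R a b I I-rec k m = CommutativeRing.trans R
  (recurrence-unique R I-rec (closedForm-solves R a b I) (closedForm-initial R a b I) k m)
  (closedForm-explicit R a b I k m)
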